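{- Let $\pi$ be a $2$-sortable permutation. Then there exists a sequence of legal operations of the $\mathfrak{D}^2\mathfrak{I}$ machine that sorts $\pi$ and which performs operation $d_0$ only in configurations where condition $(\gamma)$ holds, operation $d_1$ only in configurations where condition $(\beta)$ holds, and operation $d_2$ only in configurations where condition $(\alpha)$ holds.
   Context: The $\mathfrak{D}^2\mathfrak{I}$ machine: stacks $D_1,D_2$ (elements in decreasing order from top to bottom, top largest) followed by stack $I$ (elements in increasing order from top to bottom, top smallest). Operations: $d_0$: push next input element into $D_1$; $d_1$: pop $D_1$, push into $D_2$; $d_2$: pop $D_2$, push into $I$; $d_3$: pop $I$ and append to the output. An operation is legal if it respects the stack order restrictions ($d_3$ is considered legal if it outputs the smallest element not yet output or if no other operation is legal). A permutation of length $n$ is $2$-sortable if some sequence of legal operations produces output $12\cdots n$. $Top(X)$ is the top of stack $X$ and $Input$ the next input element; any statement about an empty stack is considered true. Conditions: $(\alpha)$: $Top(D_2)<Top(I)$; $(\beta)$: $Top(D_2)<Top(D_1)$ and $Top(D_1)<Top(I)$; $(\gamma)$: $Top(D_1)<Input$, $Input<Top(I)$, and the sequence of input elements from $Input$ up to the first input element larger than $Top(D_2)$ is increasing. -}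

module Defs where

open import Data.Nat using (ℕ; suc; _<_; _≤_)
open import Data.Nat.Properties using (_<?_)
open import Data.List using (List; []; _∷_; _++_; [_]; map; upTo)
open import Data.List.Membership.Propositional using (_∈_)
open import Data.List.Relation.Unary.Linked using (Linked)
open import Data.List.Relation.Binary.Permutation.Propositional using (_↭_)
open import Data.Product using (Σ; ∃; _×_; _,_)
open import Data.Sum using (_⊎_)
open import Data.Unit using (⊤)
open import Relation.Nullary using (¬_; yes; no)
open import Relation.Binary.PropositionalEquality using (_≡_)

-- Stacks are lists whose head is the top.
-- A configuration of the D²I machine.
record Config : Set where
  constructor cfg
  field
    input : List ℕ   -- remaining input, head = next input element
    D₁    : List ℕ
    D₂    : List ℕ
    I     : List ℕ
    out   : List ℕ

open Config public

-- "Top(X) < Top(Y)"; a statement about an empty stack is true.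
TopLt : List ℕ → List ℕ → Set
TopLt (x ∷ _) (y ∷ _) = x < y
TopLt _ _ = ⊤

-- "Top(X) > Top(Y)"-style push restriction helper: x may be pushed on a
-- stack that is decreasing from top to bottom iff x > top (or stack empty).
AboveTop : ℕ → List ℕ → Set
AboveTop x []      = ⊤
AboveTop x (y ∷ _) = y < x

-- x may be pushed on a stack increasing from top to bottom iff x < top.
BelowTop : ℕ → List ℕ → Set
BelowTop x []      = ⊤
BelowTop x (y ∷ _) = x < y

data Op : Set where
  d₀ d₁ d₂ d₃ : Op

data Step₀₁₂ : Op → Config → Config → Set where
  step-d₀ : ∀ {x inp s₁ s₂ i o} → AboveTop x s₁ →
            Step₀₁₂ d₀ (cfg (x ∷ inp) s₁ s₂ i o) (cfg inp (x ∷ s₁) s₂ i o)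
  step-d₁ : ∀ {inp x s₁ s₂ i o} → AboveTop x s₂ →
            Step₀₁₂ d₁ (cfg inp (x ∷ s₁) s₂ i o) (cfg inp s₁ (x ∷ s₂) i o)
  step-d₂ : ∀ {inp s₁ x s₂ i o} → BelowTop x i →
            Step₀₁₂ d₂ (cfg inp s₁ (x ∷ s₂) i o) (cfg inp s₁ s₂ (x ∷ i) o)

NoOtherLegal : Config → Set
NoOtherLegal c = ∀ o c' → ¬ Step₀₁₂ o c c'

-- w is the smallest element not yet output (the elements not yet output are
-- exactly those in the input and in the three stacks).
SmallestNotOutput : ℕ → Config → Set
SmallestNotOutput w c = ∀ x → x ∈ (input c ++ D₁ c ++ D₂ c ++ I c) → w ≤ x

data Step : Op → Config → Config → Set where
  legal₀₁₂ : ∀ {o c c'} → Step₀₁₂ o c c' → Step o c c'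
  step-d₃  : ∀ {inp s₁ s₂ w i o} →
             (SmallestNotOutput w (cfg inp s₁ s₂ (w ∷ i) o)
               ⊎ NoOtherLegal (cfg inp s₁ s₂ (w ∷ i) o)) →
             Step d₃ (cfg inp s₁ s₂ (w ∷ i) o) (cfg inp s₁ s₂ i (o ++ [ w ]))

data Run (Allowed : Op → Config → Set) : Config → Config → Set where
  done : ∀ {c} → Run Allowed c c
  _∷_  : ∀ {o c c' c''} → Allowed o c × Step o c c' → Run Allowed c' c'' →
         Run Allowed c c''

NoRestriction : Op → Config → Set
NoRestriction _ _ = ⊤

initial : List ℕ → Config
initial π = cfg π [] [] [] []

idPerm : ℕ → List ℕ
idPerm n = map suc (upTo n)

IsPermutation : ℕ → List ℕ → Set
IsPermutation n π = π ↭ idPerm n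

SortsWith : (Op → Config → Set) → ℕ → List ℕ → Set
SortsWith A n π = ∃ λ c → Run A (initial π) c × out c ≡ idPerm n

TwoSortable : ℕ → List ℕ → Set
TwoSortable n π = SortsWith NoRestriction n π

upToFirstAbove : ℕ → List ℕ → List ℕ
upToFirstAbove t [] = []
upToFirstAbove t (x ∷ xs) with t <? x
... | yes _ = x ∷ []
... | no  _ = x ∷ upToFirstAbove t xs

γ-segment : List ℕ → List ℕ → List ℕ
γ-segment []      inp = []
γ-segment (t ∷ _) inp = upToFirstAbove t inp

condα : Config → Set
condα c = TopLt (D₂ c) (I c)

condβ : Config → Set
condβ c = TopLt (D₂ c) (D₁ c) × TopLt (D₁ c) (I c)

condγ : Config → Set
condγ c = TopLt (D₁ c) (input c) × TopLt (input c) (I c)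
          × Linked _<_ (γ-segment (D₂ c) (input c))

Restricted : Op → Config → Set
Restricted d₀ c = condγ c
Restricted d₁ c = condβ c
Restricted d₂ c = condα c
Restricted d₃ c = ⊤

module Submission where

-- Call a configuration *completable* if some run of moves empties
-- the machine, where a move is a legal operation whose d₃ outputs the smallest
-- element not yet output.  In a sorting run every d₃ outputs the smallest
-- remaining element (the output must be 1 2 ⋯ n in this order), so the initial
-- configuration of a 2-sortable permutation is completable.
--
-- The heart of the proof is a one-step lemma (greedy-step): from a nonempty
-- completable configuration some move obeying (α), (β), (γ) leads to a
-- completable configuration.  It inspects the first move of a completing run.
-- If that move violates its condition, then either it leads to a *doomed*
-- configuration (an invariant shows these cannot be emptied), or the
-- completing run can be reordered to start with a d₃ or with a d₂ satisfying
-- (α).  Every move decreases 4|input| + 3|D₁| + 2|D₂| + |I|, so iterating the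
-- one-step lemma empties the machine, and an output invariant shows that the
-- output produced is then 1 2 ⋯ n.

open import Defs
open import Data.Nat using (ℕ; zero; suc; _+_; _*_; _<_; _≤_; _>_; _<?_; _≤?_)
open import Data.Nat.Properties using (≤-refl; <⇒≤; <-trans; ≤-trans; <-≤-trans; ≤-<-trans; <⇒≱; ≮⇒≥; ≰⇒>; ≤-antisym; n<1+n; suc-injective)
open import Data.Nat.Tactic.RingSolver using (solve-∀)
open import Data.List using (List; []; _∷_; _++_; [_]; length)
open import Data.List.Properties using (++-assoc; ++-identityʳ; ++-cancelˡ)
open import Data.List.Membership.Propositional using (_∈_; find)
open import Data.List.Membership.Propositional.Properties using (∈-++⁺ˡ; ∈-++⁺ʳ; ∈-++⁻)
open import Data.List.Relation.Unary.Any using (here; there)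
open import Data.List.Relation.Unary.All as All using (all?)
open import Data.List.Relation.Unary.All.Properties using (¬All⇒Any¬)
open import Data.List.Relation.Unary.Linked as Linked using (Linked; []; [-]; _∷_; linked?)
open import Data.List.Relation.Unary.Linked.Properties using (map⁺; applyUpTo⁺₂)
open import Data.List.Relation.Binary.Permutation.Propositional using (_↭_; ↭-sym; ↭-trans; ↭-reflexive; module PermutationReasoning)
open import Data.List.Relation.Binary.Permutation.Propositional.Properties using (shift; shifts; ++⁺ˡ; ∈-resp-↭; ↭-empty-inv; drop-∷)
open import Data.Product using (Σ; ∃-syntax; _×_; _,_; proj₁; proj₂)
open import Data.Sum using (_⊎_; inj₁; inj₂)
open import Data.Unit using (⊤; tt)
open import Data.Empty using (⊥; ⊥-elim)
open import Relation.Nullary using (¬_; yes; no)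
open import Relation.Binary.PropositionalEquality using (_≡_; refl; sym; trans; cong; module ≡-Reasoning)

top-greatest : ∀ {x xs z} → Linked _>_ (x ∷ xs) → z ∈ x ∷ xs → z ≤ x
top-greatest _       (here refl) = ≤-refl
top-greatest (x>y ∷ L) (there m) = <⇒≤ (≤-<-trans (top-greatest L m) x>y)

head-least : ∀ {y ys z} → Linked _<_ (y ∷ ys) → z ∈ y ∷ ys → y ≤ z
head-least _         (here refl) = ≤-refl
head-least (y<z ∷ L) (there m)   = <⇒≤ (<-≤-trans y<z (head-least L m))

least-or-smaller : ∀ y xs → (∀ x → x ∈ xs → y ≤ x) ⊎ (∃[ w ] w ∈ xs × w < y)
least-or-smaller y xs with all? (y ≤?_) xs
... | yes y≤all = inj₁ (λ _ m → All.lookup y≤all m)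
... | no ¬y≤all with find (¬All⇒Any¬ (y ≤?_) xs ¬y≤all)
...   | w , m , y≰w = inj₂ (w , m , ≰⇒> y≰w)

AboveTop⇒TopLt : ∀ {x s xs} → AboveTop x s → TopLt s (x ∷ xs)
AboveTop⇒TopLt {s = []}    _   = tt
AboveTop⇒TopLt {s = _ ∷ _} x>y = x>y

BelowTop⇒TopLt : ∀ {x s xs} → BelowTop x s → TopLt (x ∷ xs) s
BelowTop⇒TopLt {s = []}    _   = tt
BelowTop⇒TopLt {s = _ ∷ _} x<y = x<y

idPerm-increasing : ∀ n → Linked _<_ (idPerm n)
idPerm-increasing n = map⁺ (applyUpTo⁺₂ (λ i → i) n (λ i → n<1+n (suc i)))

remaining : Config → List ℕ
remaining c = input c ++ D₁ c ++ D₂ c ++ I c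

data Move : Op → Config → Config → Set where
  shuffle : ∀ {o c c'} → Step₀₁₂ o c c' → Move o c c'
  emit    : ∀ {inp s₁ s₂ w i o} → SmallestNotOutput w (cfg inp s₁ s₂ (w ∷ i) o) →
            Move d₃ (cfg inp s₁ s₂ (w ∷ i) o) (cfg inp s₁ s₂ i (o ++ [ w ]))

data Moves (A : Op → Config → Set) : Config → Config → Set where
  done : ∀ {c} → Moves A c c
  step : ∀ {o c c' c''} → A o c → Move o c c' → Moves A c' c'' → Moves A c c''

moves⇒run : ∀ {A c c'} → Moves A c c' → Run A c c'
moves⇒run done                   = done
moves⇒run (step a (shuffle s) r) = (a , legal₀₁₂ s) ∷ moves⇒run r
moves⇒run (step a (emit least) r) = (a , step-d₃ (inj₁ least)) ∷ moves⇒run r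

data Finished : Config → Set where
  finished : ∀ {o} → Finished (cfg [] [] [] [] o)

finished-if-nothing-remains : ∀ c → remaining c ≡ [] → Finished c
finished-if-nothing-remains (cfg [] [] [] [] o) _ = finished

Completable : Config → Set
Completable c = Σ Config λ e → Moves NoRestriction c e × Finished e

completable-after : ∀ {o c c'} → Move o c c' → Completable c' → Completable c
completable-after mv (e , r , fin) = e , step tt mv r , fin

remaining-shuffle : ∀ {o c c'} → Step₀₁₂ o c c' → remaining c' ↭ remaining c
remaining-shuffle (step-d₀ {x = a} {inp} {s₁} {s₂} {i} _) = shift a inp (s₁ ++ s₂ ++ i)
remaining-shuffle (step-d₁ {inp} {x} {s₁} {s₂} {i} _)     = ++⁺ˡ inp (shift x s₁ (s₂ ++ i))
remaining-shuffle (step-d₂ {inp} {s₁} {t} {s₂} {i} _)     = ++⁺ˡ inp (++⁺ˡ s₁ (shift t s₂ i))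

∈-remaining-shuffle : ∀ {o c c' x} → Step₀₁₂ o c c' → x ∈ remaining c → x ∈ remaining c'
∈-remaining-shuffle st = ∈-resp-↭ (↭-sym (remaining-shuffle st))

least-shuffle : ∀ {o c c' y} → Step₀₁₂ o c c' → SmallestNotOutput y c → SmallestNotOutput y c'
least-shuffle st least x m = least x (∈-resp-↭ (remaining-shuffle st) m)

out-shuffle : ∀ {o c c'} → Step₀₁₂ o c c' → out c' ≡ out c
out-shuffle (step-d₀ _) = refl
out-shuffle (step-d₁ _) = refl
out-shuffle (step-d₂ _) = refl

remaining-emit : ∀ inp s₁ s₂ w i o o' →
                 remaining (cfg inp s₁ s₂ (w ∷ i) o) ↭ w ∷ remaining (cfg inp s₁ s₂ i o')
remaining-emit inp s₁ s₂ w i _ _ = begin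
  inp ++ s₁ ++ s₂ ++ w ∷ i     ≡⟨ sym (assoc (w ∷ i)) ⟩
  (inp ++ s₁ ++ s₂) ++ w ∷ i   ↭⟨ shift w (inp ++ s₁ ++ s₂) i ⟩
  w ∷ (inp ++ s₁ ++ s₂) ++ i   ≡⟨ cong (w ∷_) (assoc i) ⟩
  w ∷ inp ++ s₁ ++ s₂ ++ i     ∎
  where
  open PermutationReasoning
  assoc : ∀ zs → (inp ++ s₁ ++ s₂) ++ zs ≡ inp ++ s₁ ++ s₂ ++ zs
  assoc zs = trans (++-assoc inp (s₁ ++ s₂) zs) (cong (inp ++_) (++-assoc s₁ s₂ zs))

StacksOrdered : Config → Set
StacksOrdered c = Linked _>_ (D₁ c) × Linked _>_ (D₂ c) × Linked _<_ (I c)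

push-decreasing : ∀ {x s} → AboveTop x s → Linked _>_ s → Linked _>_ (x ∷ s)
push-decreasing {s = []}    _   _ = [-]
push-decreasing {s = _ ∷ _} x>y L = x>y ∷ L

push-increasing : ∀ {x s} → BelowTop x s → Linked _<_ s → Linked _<_ (x ∷ s)
push-increasing {s = []}    _   _ = [-]
push-increasing {s = _ ∷ _} x<y L = x<y ∷ L

ordered-move : ∀ {o c c'} → Move o c c' → StacksOrdered c → StacksOrdered c'
ordered-move (shuffle (step-d₀ l)) (L₁ , L₂ , L₃) = push-decreasing l L₁ , L₂ , L₃
ordered-move (shuffle (step-d₁ l)) (L₁ , L₂ , L₃) = Linked.tail L₁ , push-decreasing l L₂ , L₃
ordered-move (shuffle (step-d₂ l)) (L₁ , L₂ , L₃) = L₁ , Linked.tail L₂ , push-increasing l L₃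
ordered-move (emit _)              (L₁ , L₂ , L₃) = L₁ , L₂ , Linked.tail L₃

-- Output invariant: the remaining elements, in increasing order, complete the
-- output produced so far to T.

HeadingFor : List ℕ → Config → Set
HeadingFor T c = Σ (List ℕ) λ R → remaining c ↭ R × Linked _<_ R × out c ++ R ≡ T

heading-initial : ∀ n π → IsPermutation n π → HeadingFor (idPerm n) (initial π)
heading-initial n π perm =
  idPerm n , ↭-trans (↭-reflexive (++-identityʳ π)) perm , idPerm-increasing n , refl

-- The element emitted by a move is the next element of T: being the least
-- remaining element, it is the head of the increasing list R.
heading-emit : ∀ {T inp s₁ s₂ w i o} → SmallestNotOutput w (cfg inp s₁ s₂ (w ∷ i) o) →
               HeadingFor T (cfg inp s₁ s₂ (w ∷ i) o) → HeadingFor T (cfg inp s₁ s₂ i (o ++ [ w ]))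
heading-emit {T} {inp} {s₁} {s₂} {w} {i} {o} least (R , rem↭R , incr , eq) =
  drop-head R rem↭R incr eq (∈-resp-↭ rem↭R w-rem)
  where
  before after : Config
  before = cfg inp s₁ s₂ (w ∷ i) o
  after  = cfg inp s₁ s₂ i (o ++ [ w ])
  w-rem : w ∈ remaining before
  w-rem = ∈-resp-↭ (↭-sym (remaining-emit inp s₁ s₂ w i o o)) (here refl)
  drop-head : ∀ R → remaining before ↭ R → Linked _<_ R → o ++ R ≡ T → w ∈ R → HeadingFor T after
  drop-head []       _ _ _ ()
  drop-head (r ∷ R') rem↭R incr eq w∈R = R' , rem'↭R' , Linked.tail incr , out-eq
    where
    w≡r : w ≡ r
    w≡r = ≤-antisym (least r (∈-resp-↭ (↭-sym rem↭R) (here refl))) (head-least incr w∈R)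
    rem'↭R' : remaining after ↭ R'
    rem'↭R' = drop-∷ (↭-trans (↭-sym (remaining-emit inp s₁ s₂ w i o (o ++ [ w ])))
                              (↭-trans rem↭R (↭-reflexive (cong (_∷ R') (sym w≡r)))))
    out-eq : (o ++ [ w ]) ++ R' ≡ T
    out-eq = begin
      (o ++ [ w ]) ++ R' ≡⟨ ++-assoc o [ w ] R' ⟩
      o ++ w ∷ R'        ≡⟨ cong (λ v → o ++ v ∷ R') w≡r ⟩
      o ++ r ∷ R'        ≡⟨ eq ⟩
      T                  ∎
      where open ≡-Reasoning

heading-move : ∀ {T o c c'} → Move o c c' → HeadingFor T c → HeadingFor T c'
heading-move (shuffle st) (R , rem↭R , incr , eq) =
  R , ↭-trans (remaining-shuffle st) rem↭R , incr , trans (cong (_++ R) (out-shuffle st)) eq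
heading-move (emit {inp} {s₁} {s₂} {w} {i} {o} least) h =
  heading-emit {inp = inp} {s₁} {s₂} {w} {i} {o} least h

heading-moves : ∀ {T A c c'} → Moves A c c' → HeadingFor T c → HeadingFor T c'
heading-moves done           h = h
heading-moves (step _ mv r) h = heading-moves r (heading-move mv h)

heading-finished : ∀ {T c} → HeadingFor T c → Finished c → out c ≡ T
heading-finished (R , rem↭R , _ , eq) finished
  rewrite ↭-empty-inv (↭-sym rem↭R) = trans (sym (++-identityʳ _)) eq

output-extends : ∀ {A c c'} → Run A c c' → ∃[ X ] out c' ≡ out c ++ X
output-extends done = [] , sym (++-identityʳ _)
output-extends ((_ , legal₀₁₂ st) ∷ r) with output-extends r
... | X , eq = X , trans eq (cong (_++ X) (out-shuffle st))
output-extends ((_ , step-d₃ {w = w} {o = o} _) ∷ r) with output-extends r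
... | X , eq = w ∷ X , trans eq (++-assoc o [ w ] X)

sorting-outputs-least : ∀ {A T inp s₁ s₂ w i o c'} → HeadingFor T (cfg inp s₁ s₂ (w ∷ i) o) →
                        Run A (cfg inp s₁ s₂ i (o ++ [ w ])) c' → out c' ≡ T →
                        SmallestNotOutput w (cfg inp s₁ s₂ (w ∷ i) o)
sorting-outputs-least {w = w} {o = o} (R , rem↭R , incr , eq) r sorted x m
  with output-extends r
... | X , ext with ++-cancelˡ o R (w ∷ X) (trans eq (trans (sym sorted) (trans ext (++-assoc o [ w ] X))))
... | refl = head-least incr (∈-resp-↭ rem↭R m)

sorting-run-completable : ∀ {T c c'} → HeadingFor T c → Run NoRestriction c c' → out c' ≡ T →
                          Completable c
sorting-run-completable {c = c} (R , rem↭R , _ , eq) done sorted =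
  c , done , finished-if-nothing-remains c (↭-empty-inv (↭-trans rem↭R (↭-reflexive R≡[])))
  where
  R≡[] : R ≡ []
  R≡[] = ++-cancelˡ (out c) R [] (trans eq (trans (sym sorted) (sym (++-identityʳ (out c)))))
sorting-run-completable h ((_ , legal₀₁₂ st) ∷ r) sorted =
  completable-after (shuffle st) (sorting-run-completable (heading-move (shuffle st) h) r sorted)
sorting-run-completable h ((_ , step-d₃ {inp} {s₁} {s₂} {w} {i} {o} _) ∷ r) sorted =
  completable-after mv (sorting-run-completable (heading-move mv h) r sorted)
  where
  mv : Move d₃ (cfg inp s₁ s₂ (w ∷ i) o) (cfg inp s₁ s₂ i (o ++ [ w ]))
  mv = emit (sorting-outputs-least {inp = inp} {s₁} {s₂} {w} {i} {o} h r sorted)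

data Before (u w : ℕ) : List ℕ → Set where
  here  : ∀ {xs} → w ∈ xs → Before u w (u ∷ xs)
  there : ∀ {z xs} → Before u w xs → Before u w (z ∷ xs)

before-mem : ∀ {u w xs} → Before u w xs → w ∈ xs
before-mem (here m)  = there m
before-mem (there b) = there (before-mem b)

before-after : ∀ {u w} (A : List ℕ) {B} → w ∈ B → Before u w (A ++ u ∷ B)
before-after []      m = here m
before-after (_ ∷ A) m = there (before-after A m)

overtake : ∀ {u w} (A B : List ℕ) a C → Before u w (A ++ B ++ a ∷ C) →
           Before u w (A ++ a ∷ B ++ C) ⊎ (u ∈ B × w ≡ a)
overtake []      []      a C b = inj₁ b
overtake []      (_ ∷ B) a C (here m) with ∈-++⁻ B m
... | inj₁ m∈B         = inj₁ (there (here (∈-++⁺ˡ m∈B)))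
... | inj₂ (here w≡a)  = inj₂ (here refl , w≡a)
... | inj₂ (there m∈C) = inj₁ (there (here (∈-++⁺ʳ B m∈C)))
overtake []      (_ ∷ B) a C (there b) with overtake [] B a C b
... | inj₁ (here m)      = inj₁ (here (there m))
... | inj₁ (there b')    = inj₁ (there (there b'))
... | inj₂ (u∈B , w≡a)   = inj₂ (there u∈B , w≡a)
overtake (_ ∷ A) B a C (here m)  = inj₁ (here (∈-resp-↭ (++⁺ˡ A (shift a B C)) m))
overtake (_ ∷ A) B a C (there b) with overtake A B a C b
... | inj₁ b'  = inj₁ (there b')
... | inj₂ u∈B = inj₂ u∈B

pipeline : Config → List ℕ
pipeline c = D₂ c ++ D₁ c ++ input c

remaining↭pipeline++I : ∀ c → remaining c ↭ pipeline c ++ I c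
remaining↭pipeline++I (cfg inp s₁ s₂ i _) = begin
  inp ++ s₁ ++ s₂ ++ i     ↭⟨ shifts inp s₁ ⟩
  s₁ ++ inp ++ s₂ ++ i     ↭⟨ ++⁺ˡ s₁ (shifts inp s₂) ⟩
  s₁ ++ s₂ ++ inp ++ i     ↭⟨ shifts s₁ s₂ ⟩
  s₂ ++ s₁ ++ inp ++ i     ≡⟨ sym (trans (++-assoc s₂ (s₁ ++ inp) i) (cong (s₂ ++_) (++-assoc s₁ inp i))) ⟩
  (s₂ ++ s₁ ++ inp) ++ i   ∎
  where open PermutationReasoning

pipeline-remaining : ∀ {c w} → w ∈ pipeline c → w ∈ remaining c
pipeline-remaining {c} m = ∈-resp-↭ (↭-sym (remaining↭pipeline++I c)) (∈-++⁺ˡ m)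

remaining-pipeline : ∀ {c w} → w ∈ remaining c → ¬ w ∈ I c → w ∈ pipeline c
remaining-pipeline {c} m w∉I with ∈-++⁻ (pipeline c) (∈-resp-↭ (remaining↭pipeline++I c) m)
... | inj₁ m' = m'
... | inj₂ w∈I = ⊥-elim (w∉I w∈I)

below-top-∉ : ∀ {w y i} → Linked _<_ (y ∷ i) → w < y → ¬ w ∈ y ∷ i
below-top-∉ L w<y m = <⇒≱ w<y (head-least L m)

-- Some y ∈ I, w < y ≤ u with u before w in the pipeline.  Then w must be
-- output before y, u cannot enter I while y is there, and the stack orders
-- never let w overtake u: such a configuration cannot be emptied.
Doomed : Config → Set
Doomed c = ∃[ u ] ∃[ w ] ∃[ y ] y ∈ I c × w < y × y ≤ u × Before u w (pipeline c)

-- An element pushed above a decreasing stack exceeds all of it, so it is not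
-- below any y ≤ u ∈ s.
pushed-above : ∀ {a s u y} → AboveTop a s → Linked _>_ s → u ∈ s → a < y → y ≤ u → ⊥
pushed-above {s = _ ∷ _} a>top L u∈s a<y y≤u =
  <⇒≱ (<-trans a<y (≤-<-trans y≤u (≤-<-trans (top-greatest L u∈s) a>top))) ≤-refl

-- An element pushed onto an increasing stack is below all of it, so it is not
-- ≥ any y ∈ i.
pushed-below : ∀ {t i y} → BelowTop t i → Linked _<_ i → y ∈ i → y ≤ t → ⊥
pushed-below {i = _ ∷ _} t<top L y∈i y≤t = <⇒≱ (<-≤-trans t<top (head-least L y∈i)) y≤t

doomed-move : ∀ {o c c'} → StacksOrdered c → Move o c c' → Doomed c → Doomed c'
doomed-move (L₁ , _ , _) (shuffle (step-d₀ {x = a} {inp} {s₁} {s₂} l)) (u , w , y , y∈I , w<y , y≤u , b)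
  with overtake s₂ s₁ a inp b
... | inj₁ b'           = u , w , y , y∈I , w<y , y≤u , b'
... | inj₂ (u∈s₁ , refl) = ⊥-elim (pushed-above l L₁ u∈s₁ w<y y≤u)
doomed-move (_ , L₂ , _) (shuffle (step-d₁ {inp} {x} {s₁} {s₂} l)) (u , w , y , y∈I , w<y , y≤u , b)
  with overtake [] s₂ x (s₁ ++ inp) b
... | inj₁ b'           = u , w , y , y∈I , w<y , y≤u , b'
... | inj₂ (u∈s₂ , refl) = ⊥-elim (pushed-above l L₂ u∈s₂ w<y y≤u)
doomed-move (_ , _ , L₃) (shuffle (step-d₂ l)) (u , w , y , y∈I , w<y , y≤u , here _) =
  ⊥-elim (pushed-below l L₃ y∈I y≤u)
doomed-move _ (shuffle (step-d₂ l)) (u , w , y , y∈I , w<y , y≤u , there b) =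
  u , w , y , there y∈I , w<y , y≤u , b
doomed-move {c = c} _ (emit least) (u , w , y , here refl , w<y , y≤u , b) =
  ⊥-elim (<⇒≱ w<y (least w (pipeline-remaining {c} (before-mem b))))
doomed-move _ (emit _) (u , w , y , there y∈I , w<y , y≤u , b) = u , w , y , y∈I , w<y , y≤u , b

doomed-incompletable : ∀ {c} → StacksOrdered c → Doomed c → ¬ Completable c
doomed-incompletable _ (_ , _ , _ , () , _) (_ , done , finished)
doomed-incompletable ord doom (e , step _ mv r , fin) =
  doomed-incompletable (ordered-move mv ord) (doomed-move ord mv doom) (e , r , fin)

-- Some remaining element is below the top of I, so d₃ is not a move
-- (vacuous when I is empty).
Blocked : Config → Set
Blocked (cfg _ _ _ [] _)        = ⊤
Blocked c@(cfg _ _ _ (y ∷ _) _) = ∃[ w ] w ∈ remaining c × w < y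

blocked-d₀ : ∀ {c c'} → Step₀₁₂ d₀ c c' → Blocked c → Blocked c'
blocked-d₀ (step-d₀ {i = []} _) _                     = tt
blocked-d₀ st@(step-d₀ {i = _ ∷ _} _) (w , m , w<y) = w , ∈-remaining-shuffle st m , w<y

blocked-no-emit : ∀ {c c'} → Blocked c → ¬ Move d₃ c c'
blocked-no-emit (w , m , w<y) (emit least) = <⇒≱ w<y (least w m)

-- If the top of I is the smallest remaining element, a completing run may
-- output it first: until it does, it can only perform d₀ and d₁.
emit-first : ∀ {inp s₁ s₂ y i o} → SmallestNotOutput y (cfg inp s₁ s₂ (y ∷ i) o) →
             Completable (cfg inp s₁ s₂ (y ∷ i) o) → Completable (cfg inp s₁ s₂ i (o ++ [ y ]))
emit-first least (_ , done , ())
emit-first least (e , step _ (shuffle st@(step-d₀ l)) r , fin) =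
  completable-after (shuffle (step-d₀ l)) (emit-first (least-shuffle st least) (e , r , fin))
emit-first least (e , step _ (shuffle st@(step-d₁ l)) r , fin) =
  completable-after (shuffle (step-d₁ l)) (emit-first (least-shuffle st least) (e , r , fin))
emit-first {inp} {s₁} least (_ , step _ (shuffle (step-d₂ {x = t} t<y)) _ , _) =
  ⊥-elim (<⇒≱ t<y (least t (∈-++⁺ʳ inp (∈-++⁺ʳ s₁ (here refl)))))
emit-first least (e , step _ (emit _) r , fin) = e , r , fin

Progress : Config → Set
Progress c = ∃[ op ] ∃[ c' ] Restricted op c × Move op c c' × Completable c'

-- Let Hold be preserved by d₀ and forbid completing after a d₁.  If Hold
-- holds and d₃ is blocked, a completing run performs d₀'s and then moves the
-- top t of D₂ to I; so it may move t first.
module D₂First (Hold : Config → Set)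
  (hold-d₀ : ∀ {c c'} → Hold c → Step₀₁₂ d₀ c c' → Hold c')
  (hold-no-d₁ : ∀ {c c'} → StacksOrdered c → Hold c → Step₀₁₂ d₁ c c' → ¬ Completable c')
  where

  d₂-first : ∀ {inp s₁ t s₂ i o} → StacksOrdered (cfg inp s₁ (t ∷ s₂) i o) →
             Hold (cfg inp s₁ (t ∷ s₂) i o) → Blocked (cfg inp s₁ (t ∷ s₂) i o) →
             Completable (cfg inp s₁ (t ∷ s₂) i o) →
             BelowTop t i × Completable (cfg inp s₁ s₂ (t ∷ i) o)
  d₂-first ord hold blk (_ , done , ())
  d₂-first ord hold blk (e , step _ (shuffle st@(step-d₀ l)) r , fin)
    with d₂-first (ordered-move (shuffle st) ord) (hold-d₀ hold st) (blocked-d₀ st blk) (e , r , fin)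
  ... | t<I , comp = t<I , completable-after (shuffle (step-d₀ l)) comp
  d₂-first ord hold blk (e , step _ (shuffle st@(step-d₁ _)) r , fin) =
    ⊥-elim (hold-no-d₁ ord hold st (e , r , fin))
  d₂-first ord hold blk (e , step _ (shuffle (step-d₂ t<I)) r , fin) = t<I , e , r , fin
  d₂-first ord hold blk (_ , step _ mv@(emit _) _ , _) = ⊥-elim (blocked-no-emit blk mv)

  -- In particular a completing run starting with d₀ may start with d₂ instead.
  d₂-before-d₀ : ∀ {a inp s₁ t s₂ i o} → StacksOrdered (cfg (a ∷ inp) s₁ (t ∷ s₂) i o) →
                 Blocked (cfg (a ∷ inp) s₁ (t ∷ s₂) i o) → AboveTop a s₁ →
                 Hold (cfg inp (a ∷ s₁) (t ∷ s₂) i o) → Completable (cfg inp (a ∷ s₁) (t ∷ s₂) i o) →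
                 Progress (cfg (a ∷ inp) s₁ (t ∷ s₂) i o)
  d₂-before-d₀ {a} {inp} {s₁} {t} {s₂} {i} {o} ord blk a>top hold comp =
    d₂ , _ , BelowTop⇒TopLt t<I , shuffle (step-d₂ t<I) , completable-after (shuffle push-after-d₂) comp'
    where
    push : Step₀₁₂ d₀ (cfg (a ∷ inp) s₁ (t ∷ s₂) i o) (cfg inp (a ∷ s₁) (t ∷ s₂) i o)
    push = step-d₀ a>top
    moved : BelowTop t i × Completable (cfg inp (a ∷ s₁) s₂ (t ∷ i) o)
    moved = d₂-first (ordered-move (shuffle push) ord) hold (blocked-d₀ push blk) comp
    t<I : BelowTop t i
    t<I = proj₁ moved
    comp' : Completable (cfg inp (a ∷ s₁) s₂ (t ∷ i) o)
    comp' = proj₂ moved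
    push-after-d₂ : Step₀₁₂ d₀ (cfg (a ∷ inp) s₁ s₂ (t ∷ i) o) (cfg inp (a ∷ s₁) s₂ (t ∷ i) o)
    push-after-d₂ = step-d₀ a>top

-- After a d₀ violating (γ), with t = Top(D₂): Top(D₁) = x cannot move onto D₂,
-- and x followed by the input up to the first element above t is not increasing.
γ-Violated : Config → Set
γ-Violated (cfg inp (x ∷ _) (t ∷ _) _ _) = ¬ t < x × ¬ Linked _<_ (x ∷ upToFirstAbove t inp)
γ-Violated _                             = ⊥

γ-violated-push : ∀ {t a inp} → ¬ Linked _<_ (upToFirstAbove t (a ∷ inp)) →
                  ¬ t < a × ¬ Linked _<_ (a ∷ upToFirstAbove t inp)
γ-violated-push {t} {a} ¬incr with t <? a
... | yes _   = ⊥-elim (¬incr [-])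
... | no t≮a = t≮a , ¬incr

-- A legal d₀ pushes a larger element, which keeps the segment non-increasing.
γ-violated-d₀ : ∀ {c c'} → γ-Violated c → Step₀₁₂ d₀ c c' → γ-Violated c'
γ-violated-d₀ (_ , ¬incr) (step-d₀ {s₁ = _ ∷ _} {s₂ = _ ∷ _} x<a) =
  γ-violated-push (λ incr → ¬incr (linked-cons x<a incr))
  where
  linked-cons : ∀ {x a t inp} → x < a → Linked _<_ (upToFirstAbove t (a ∷ inp)) →
                Linked _<_ (x ∷ upToFirstAbove t (a ∷ inp))
  linked-cons {a = a} {t} x<a incr with t <? a
  ... | yes _ = x<a ∷ incr
  ... | no _  = x<a ∷ incr

γ-violated-no-d₁ : ∀ {c c'} → StacksOrdered c → γ-Violated c → Step₀₁₂ d₁ c c' → ¬ Completable c'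
γ-violated-no-d₁ _ (t≮x , _) (step-d₁ {s₂ = _ ∷ _} t<x) _ = t≮x t<x

module AfterγViolation = D₂First γ-Violated γ-violated-d₀ γ-violated-no-d₁

-- After a d₀ pushing an element ≥ Top(I) = y while some element of D₂ is below
-- y: then y ≤ Top(D₁), so a d₁ would doom the machine.
I-Overtaken : Config → Set
I-Overtaken (cfg _ (x ∷ _) s₂ (y ∷ _) _) = y ≤ x × ∃[ v ] v ∈ s₂ × v < y
I-Overtaken _                            = ⊥

I-overtaken-d₀ : ∀ {c c'} → I-Overtaken c → Step₀₁₂ d₀ c c' → I-Overtaken c'
I-overtaken-d₀ (y≤x , below) (step-d₀ {s₁ = _ ∷ _} {i = _ ∷ _} x<a) = ≤-trans y≤x (<⇒≤ x<a) , below

I-overtaken-no-d₁ : ∀ {c c'} → StacksOrdered c → I-Overtaken c → Step₀₁₂ d₁ c c' → ¬ Completable c'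
I-overtaken-no-d₁ ord (y≤x , v , v∈s₂ , v<y) st@(step-d₁ {x = x} {i = y ∷ _} _) =
  doomed-incompletable (ordered-move (shuffle st) ord) (x , v , y , here refl , v<y , y≤x , here (∈-++⁺ˡ v∈s₂))

module AfterIOvertaken = D₂First I-Overtaken I-overtaken-d₀ I-overtaken-no-d₁

-- A blocked d₁ moving x onto D₂ satisfies (β) unless x ≥ Top(I) = y; then x
-- precedes some remaining w < y afterwards, which dooms the machine.
greedy-d₁ : ∀ {c c'} → StacksOrdered c → Blocked c → Step₀₁₂ d₁ c c' → Completable c' → Progress c
greedy-d₁ _ _ st@(step-d₁ {i = []} x>top) comp = d₁ , _ , (AboveTop⇒TopLt x>top , tt) , shuffle st , comp
greedy-d₁ ord (w , w-rem , w<y) st@(step-d₁ {inp} {x} {s₁} {s₂} {y ∷ i} {o} x>top) comp with x <? y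
... | yes x<y = d₁ , _ , (AboveTop⇒TopLt x>top , x<y) , shuffle st , comp
... | no x≮y  = ⊥-elim (doomed-incompletable ord' (x , w , y , here refl , w<y , y≤x , x-before-w w∈pipeline) comp)
  where
  c' : Config
  c' = cfg inp s₁ (x ∷ s₂) (y ∷ i) o
  ord' : StacksOrdered c'
  ord' = ordered-move (shuffle st) ord
  y≤x : y ≤ x
  y≤x = ≮⇒≥ x≮y
  w∈pipeline : w ∈ pipeline c'
  w∈pipeline = remaining-pipeline {c'} (∈-remaining-shuffle st w-rem) (below-top-∉ (proj₂ (proj₂ ord')) w<y)
  x-before-w : ∀ {xs} → w ∈ x ∷ xs → Before x w (x ∷ xs)
  x-before-w (here refl) = ⊥-elim (<⇒≱ w<y y≤x)
  x-before-w (there m)   = here m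

-- A blocked d₀ with Input below Top(I) satisfies (γ) unless the input up to
-- the first element above Top(D₂) is not increasing; then d₂ may come first.
greedy-d₀-below : ∀ {a inp s₁ s₂ i o} → StacksOrdered (cfg (a ∷ inp) s₁ s₂ i o) →
                  Blocked (cfg (a ∷ inp) s₁ s₂ i o) → AboveTop a s₁ → TopLt (a ∷ inp) i →
                  Completable (cfg inp (a ∷ s₁) s₂ i o) → Progress (cfg (a ∷ inp) s₁ s₂ i o)
greedy-d₀-below {s₂ = []} _ _ a>top a<I comp =
  d₀ , _ , (AboveTop⇒TopLt a>top , a<I , []) , shuffle (step-d₀ a>top) , comp
greedy-d₀-below {a} {inp} {s₂ = t ∷ _} ord blk a>top a<I comp with linked? _<?_ (upToFirstAbove t (a ∷ inp))
... | yes incr  = d₀ , _ , (AboveTop⇒TopLt a>top , a<I , incr) , shuffle (step-d₀ a>top) , comp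
... | no ¬incr = AfterγViolation.d₂-before-d₀ ord blk a>top (γ-violated-push ¬incr) comp

-- Once Input a ≥ Top(I) = y and some element of D₂ is below y, a completing
-- run starting with the push of a may move Top(D₂) to I first.
overtaken-progress : ∀ {a inp s₁ s₂ y i o w} → StacksOrdered (cfg (a ∷ inp) s₁ s₂ (y ∷ i) o) →
                     Blocked (cfg (a ∷ inp) s₁ s₂ (y ∷ i) o) → AboveTop a s₁ → y ≤ a → w ∈ s₂ → w < y →
                     Completable (cfg inp (a ∷ s₁) s₂ (y ∷ i) o) → Progress (cfg (a ∷ inp) s₁ s₂ (y ∷ i) o)
overtaken-progress {s₂ = []}    _   _   _     _   ()   _   _
overtaken-progress {s₂ = _ ∷ _} ord blk a>top y≤a w∈s₂ w<y comp =
  AfterIOvertaken.d₂-before-d₀ ord blk a>top (y≤a , _ , w∈s₂ , w<y) comp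

-- A blocked d₀ pushing a ≥ Top(I) = y: the remaining w < y is not a; if it
-- lies behind a in the pipeline the push dooms the machine, so w ∈ D₂.
greedy-d₀-above : ∀ {a inp s₁ s₂ y i o} → StacksOrdered (cfg (a ∷ inp) s₁ s₂ (y ∷ i) o) →
                  Blocked (cfg (a ∷ inp) s₁ s₂ (y ∷ i) o) → AboveTop a s₁ → y ≤ a →
                  Completable (cfg inp (a ∷ s₁) s₂ (y ∷ i) o) → Progress (cfg (a ∷ inp) s₁ s₂ (y ∷ i) o)
greedy-d₀-above {a} {inp} {s₁} {s₂} {y} {i} {o} ord blk@(w , w-rem , w<y) a>top y≤a comp =
  locate (∈-++⁻ s₂ w∈pipeline)
  where
  c' : Config
  c' = cfg inp (a ∷ s₁) s₂ (y ∷ i) o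
  push : Step₀₁₂ d₀ (cfg (a ∷ inp) s₁ s₂ (y ∷ i) o) c'
  push = step-d₀ a>top
  w∈pipeline : w ∈ pipeline c'
  w∈pipeline = remaining-pipeline {c'} (∈-remaining-shuffle push w-rem) (below-top-∉ (proj₂ (proj₂ ord)) w<y)
  locate : w ∈ s₂ ⊎ w ∈ a ∷ s₁ ++ inp → Progress (cfg (a ∷ inp) s₁ s₂ (y ∷ i) o)
  locate (inj₁ w∈s₂)        = overtaken-progress ord blk a>top y≤a w∈s₂ w<y comp
  locate (inj₂ (here refl)) = ⊥-elim (<⇒≱ w<y y≤a)
  locate (inj₂ (there m))   = ⊥-elim (doomed-incompletable (ordered-move (shuffle push) ord)
                                        (a , w , y , here refl , w<y , y≤a , before-after s₂ m) comp)

greedy-d₀ : ∀ {c c'} → StacksOrdered c → Blocked c → Step₀₁₂ d₀ c c' → Completable c' → Progress c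
greedy-d₀ ord blk (step-d₀ {i = []} a>top) comp = greedy-d₀-below ord blk a>top tt comp
greedy-d₀ ord blk (step-d₀ {x = a} {i = y ∷ _} a>top) comp with a <? y
... | yes a<y = greedy-d₀-below ord blk a>top a<y comp
... | no a≮y  = greedy-d₀-above ord blk a>top (≮⇒≥ a≮y) comp

greedy-blocked : ∀ {c} → StacksOrdered c → Blocked c → Completable c → Finished c ⊎ Progress c
greedy-blocked _   _   (_ , done , fin) = inj₁ fin
greedy-blocked _   blk (_ , step _ mv@(emit _) _ , _) = ⊥-elim (blocked-no-emit blk mv)
greedy-blocked _   _   (e , step _ (shuffle st@(step-d₂ t<I)) r , fin) =
  inj₂ (d₂ , _ , BelowTop⇒TopLt t<I , shuffle st , e , r , fin)
greedy-blocked ord blk (e , step _ (shuffle st@(step-d₁ _)) r , fin) = inj₂ (greedy-d₁ ord blk st (e , r , fin))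
greedy-blocked ord blk (e , step _ (shuffle st@(step-d₀ _)) r , fin) = inj₂ (greedy-d₀ ord blk st (e , r , fin))

greedy-step : ∀ {c} → StacksOrdered c → Completable c → Finished c ⊎ Progress c
greedy-step {cfg _ _ _ [] _} ord comp = greedy-blocked ord tt comp
greedy-step {c@(cfg _ _ _ (y ∷ _) _)} ord comp with least-or-smaller y (remaining c)
... | inj₁ least   = inj₂ (d₃ , _ , tt , emit least , emit-first least comp)
... | inj₂ smaller = greedy-blocked ord smaller comp

-- Each element still has to travel through the remaining stacks.
weight : Config → ℕ
weight c = 4 * length (input c) + 3 * length (D₁ c) + 2 * length (D₂ c) + length (I c)

weight-move : ∀ {o c c'} → Move o c c' → weight c ≡ suc (weight c')
weight-move (shuffle (step-d₀ {inp = inp} {s₁} {s₂} {i} _)) =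
  arith (length inp) (length s₁) (length s₂) (length i)
  where
  arith : ∀ A B C D → 4 * suc A + 3 * B + 2 * C + D ≡ suc (4 * A + 3 * suc B + 2 * C + D)
  arith = solve-∀
weight-move (shuffle (step-d₁ {inp} {_} {s₁} {s₂} {i} _)) =
  arith (length inp) (length s₁) (length s₂) (length i)
  where
  arith : ∀ A B C D → 4 * A + 3 * suc B + 2 * C + D ≡ suc (4 * A + 3 * B + 2 * suc C + D)
  arith = solve-∀
weight-move (shuffle (step-d₂ {inp} {s₁} {_} {s₂} {i} _)) =
  arith (length inp) (length s₁) (length s₂) (length i)
  where
  arith : ∀ A B C D → 4 * A + 3 * B + 2 * suc C + D ≡ suc (4 * A + 3 * B + 2 * C + suc D)
  arith = solve-∀
weight-move (emit {inp} {s₁} {s₂} {_} {i} _) =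
  arith (length inp) (length s₁) (length s₂) (length i)
  where
  arith : ∀ A B C D → 4 * A + 3 * B + 2 * C + suc D ≡ suc (4 * A + 3 * B + 2 * C + D)
  arith = solve-∀

greedy-run : ∀ n {c} → weight c ≡ n → StacksOrdered c → Completable c →
             Σ Config λ f → Moves Restricted c f × Finished f
greedy-run n _ ord comp with greedy-step ord comp
greedy-run n        _  _   _ | inj₁ fin = _ , done , fin
greedy-run zero     w≡0 _   _ | inj₂ (_ , _ , _ , mv , _) with trans (sym w≡0) (weight-move mv)
... | ()
greedy-run (suc n) w≡n ord _ | inj₂ (_ , _ , cond , mv , comp')
  with greedy-run n (suc-injective (trans (sym (weight-move mv)) w≡n)) (ordered-move mv ord) comp'
... | f , moves , fin = f , step cond mv moves , fin

proposition1 : (n : ℕ) (π : List ℕ) → IsPermutation n π →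
    TwoSortable n π → SortsWith Restricted n π
proposition1 n π perm (_ , sorting-run , sorted) =
  let heading : HeadingFor (idPerm n) (initial π)
      heading = heading-initial n π perm
      (f , moves , fin) = greedy-run _ refl ([] , [] , [])
                                     (sorting-run-completable heading sorting-run sorted)
  in f , moves⇒run moves , heading-finished (heading-moves moves heading) fin
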